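{- Let $m\ge 1$ and let $(r_1,\ldots,r_m)$ and $(c_1,\ldots,c_m)$ be integers satisfying $r_1+\cdots+r_m=c_1+\cdots+c_m$, $m\ge r_1\ge\cdots\ge r_m\ge 0$, $m\ge c_1\ge\cdots\ge c_m\ge 0$, and $r_{j+1}\ge r_j-1$ and $c_{j+1}\ge c_j-1$ for $1\le j<m$. Then there exists an $m\times m$ matrix of 0s and 1s having row sums $(r_1,\ldots,r_m)$ and column sums $(c_1,\ldots,c_m)$. -}

module Defs where

open import Data.Nat using (ℕ; _+_)
open import Data.Fin using (Fin)
open import Data.Bool using (Bool; true; false)
import Data.Vec.Functional as VF

∑ : ∀ {n} → (Fin n → ℕ) → ℕ
∑ f = VF.foldr _+_ 0 f

bit : Bool → ℕ
bit false = 0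
bit true  = 1

BinMatrix : ℕ → ℕ → Set
BinMatrix m n = Fin m → Fin n → Bool

rowSum : ∀ {m n} → BinMatrix m n → Fin m → ℕ
rowSum A i = ∑ (λ j → bit (A i j))

colSum : ∀ {m n} → BinMatrix m n → Fin n → ℕ
colSum A j = ∑ (λ i → bit (A i j))

{-# OPTIONS --safe #-}
module Submission where

-- Fill the matrix row by row. The first row puts its r₁ ones into the r₁ largest columns, taking
-- the rightmost ones among equal column sums; the remaining column sums are then again nonincreasing
-- with steps of at most one, and at most m − 1, because the columns of full height m form a leading
-- run of length ≤ r₁ (m · run ≤ ∑ c = ∑ r ≤ m · r₁). At least r₁ columns are nonzero: if only
-- q < r₁ (< m) are, then c has a zero, so removing one unit from every positive column lowers the
-- number of positive columns each time, giving ∑ c ≤ q + (q − 1) + ⋯ < r₁ + (r₁ − 1) + ⋯ ≤ ∑ r.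

open import Defs
open import Data.Nat using (ℕ; zero; suc; _≤_; _<_; _∸_; _+_; _*_; z≤n; s≤s; s≤s⁻¹; _≤?_; _≟_)
open import Data.Nat.Properties
open import Algebra.Properties.CommutativeMonoid.Sum +-0-commutativeMonoid using (sum-cong-≗; ∑-distrib-+)
open import Data.Fin using (Fin; toℕ; zero; suc)
open import Data.Vec.Functional using (tail; _∷_)
open import Data.Bool using (Bool; true; false)
open import Data.Product using (Σ; _×_; _,_; proj₁; proj₂; map)
open import Data.Sum using (inj₁; inj₂)
open import Function using (_∘_; id)
open import Relation.Nullary using (yes; no; ¬_; contradiction)
open import Relation.Binary.PropositionalEquality

∑-mono-≤ : ∀ {n} {f g : Fin n → ℕ} → (∀ i → f i ≤ g i) → ∑ f ≤ ∑ g
∑-mono-≤ {zero}  f≤g = z≤n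
∑-mono-≤ {suc n} f≤g = +-mono-≤ (f≤g zero) (∑-mono-≤ (f≤g ∘ suc))

∑-≤-* : ∀ {n M} {f : Fin n → ℕ} → (∀ i → f i ≤ M) → ∑ f ≤ n * M
∑-≤-* {zero}  f≤M = z≤n
∑-≤-* {suc n} f≤M = +-mono-≤ (f≤M zero) (∑-≤-* (f≤M ∘ suc))

∑-≤-0 : ∀ {n} {f : Fin n → ℕ} → (∀ i → f i ≤ 0) → ∑ f ≤ 0
∑-≤-0 {n} f≤0 = ≤-trans (∑-≤-* f≤0) (≤-reflexive (*-zeroʳ n))

sgn : ℕ → ℕ
sgn zero    = 0
sgn (suc _) = 1

sgn-mono-≤ : ∀ {m n} → m ≤ n → sgn m ≤ sgn n
sgn-mono-≤ {zero}          _ = z≤n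
sgn-mono-≤ {suc _} {suc _} _ = ≤-refl

sgn+∸1 : ∀ x → sgn x + (x ∸ 1) ≡ x
sgn+∸1 zero    = refl
sgn+∸1 (suc x) = refl

#positive : ∀ {n} → (Fin n → ℕ) → ℕ
#positive c = ∑ (sgn ∘ c)

∑≡#positive+∑∸1 : ∀ {n} (c : Fin n → ℕ) → ∑ c ≡ #positive c + ∑ ((_∸ 1) ∘ c)
∑≡#positive+∑∸1 c = trans (sum-cong-≗ (sym ∘ sgn+∸1 ∘ c)) (∑-distrib-+ (sgn ∘ c) ((_∸ 1) ∘ c))

#positive-∸1≤ : ∀ {n} (c : Fin n → ℕ) → #positive ((_∸ 1) ∘ c) ≤ #positive c
#positive-∸1≤ c = ∑-mono-≤ (λ j → sgn-mono-≤ (m∸n≤m (c j) 1))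

bit≤1 : ∀ b → bit b ≤ 1
bit≤1 false = z≤n
bit≤1 true  = ≤-refl

_∸ᵇ_ : ∀ {n} → (Fin n → ℕ) → (Fin n → Bool) → Fin n → ℕ
(c ∸ᵇ d) j = c j ∸ bit (d j)

∑-∸ᵇ : ∀ {n} {c : Fin n → ℕ} {d : Fin n → Bool} → (∀ j → bit (d j) ≤ c j) →
       ∑ c ≡ ∑ (bit ∘ d) + ∑ (c ∸ᵇ d)
∑-∸ᵇ {c = c} {d} d≤c =
  trans (sum-cong-≗ (λ j → sym (m+[n∸m]≡n (d≤c j)))) (∑-distrib-+ (bit ∘ d) (c ∸ᵇ d))

SmoothStep : ℕ → ℕ → Set
SmoothStep a b = b ≤ a × a ∸ 1 ≤ b

smoothStep-∸-bit : ∀ a b → SmoothStep a (a ∸ bit b)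
smoothStep-∸-bit a b = m∸n≤m a (bit b) , ∸-monoʳ-≤ a (bit≤1 b)

smoothStep-≢ : ∀ {a b} → SmoothStep a b → b ≢ a → b ≡ a ∸ 1
smoothStep-≢ (b≤a , a∸1≤b) b≢a = ≤-antisym (∸-monoˡ-≤ 1 (≤∧≢⇒< b≤a b≢a)) a∸1≤b

Smooth : ∀ {n} → (Fin n → ℕ) → Set
Smooth c = ∀ i j → toℕ i + 1 ≡ toℕ j → SmoothStep (c i) (c j)

smooth-head : ∀ {n} {c : Fin (suc (suc n)) → ℕ} → Smooth c → SmoothStep (c zero) (c (suc zero))
smooth-head s = s zero (suc zero) refl

smooth-tail : ∀ {n} {c : Fin (suc n) → ℕ} → Smooth c → Smooth (tail c)
smooth-tail s i j i+1≡j = s (suc i) (suc j) (cong suc i+1≡j)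

smooth-singleton : ∀ (c : Fin 1 → ℕ) → Smooth c
smooth-singleton c zero zero ()

smooth-∷ : ∀ {n} {c : Fin (suc (suc n)) → ℕ} → SmoothStep (c zero) (c (suc zero)) → Smooth (tail c) →
           Smooth c
smooth-∷ step s zero    (suc zero) refl  = step
smooth-∷ step s (suc i) (suc j)    i+1≡j = s i j (suc-injective i+1≡j)

smooth-∸1 : ∀ {n} {c : Fin n → ℕ} → Smooth c → Smooth ((_∸ 1) ∘ c)
smooth-∸1 s i j i+1≡j = map (∸-monoˡ-≤ 1) (∸-monoˡ-≤ 1) (s i j i+1≡j)

smooth-head-max : ∀ {n} {c : Fin (suc n) → ℕ} → Smooth c → ∀ j → c j ≤ c zero
smooth-head-max         s zero    = ≤-refl
smooth-head-max {suc n} s (suc j) = ≤-trans (smooth-head-max (smooth-tail s) j) (proj₁ (smooth-head s))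

smooth-head-∸-≤ : ∀ {n} {c : Fin (suc n) → ℕ} → Smooth c → ∀ i → c zero ∸ toℕ i ≤ c i
smooth-head-∸-≤             s zero    = ≤-refl
smooth-head-∸-≤ {suc n} {c} s (suc i) = begin
  c zero ∸ suc (toℕ i)     ≡⟨ ∸-+-assoc (c zero) 1 (toℕ i) ⟨
  c zero ∸ 1 ∸ toℕ i       ≤⟨ ∸-monoˡ-≤ (toℕ i) (proj₂ (smooth-head s)) ⟩
  c (suc zero) ∸ toℕ i     ≤⟨ smooth-head-∸-≤ (smooth-tail s) i ⟩
  c (suc i)                ∎
  where open ≤-Reasoning

#positive-head≡0 : ∀ {n} {c : Fin (suc n) → ℕ} → Smooth c → c zero ≡ 0 → #positive c ≡ 0
#positive-head≡0 s c₀≡0 =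
  n≤0⇒n≡0 (∑-≤-0 (λ j → sgn-mono-≤ (≤-trans (smooth-head-max s j) (≤-reflexive c₀≡0))))

head-positive : ∀ {n} {c : Fin (suc n) → ℕ} → Smooth c → 1 ≤ #positive c → 1 ≤ c zero
head-positive s 1≤#c = n≢0⇒n>0 (λ c₀≡0 → <⇒≢ 1≤#c (sym (#positive-head≡0 s c₀≡0)))

#positive-tail : ∀ {n} {c : Fin (suc n) → ℕ} → Smooth c → #positive (tail c) ≤ #positive c ∸ 1
#positive-tail {c = c} s with c zero in c₀≡
... | zero  = ≤-trans (≤-trans (m≤n+m _ (sgn (c zero))) (≤-reflexive (#positive-head≡0 s c₀≡))) z≤n
... | suc _ = ≤-refl

-- #positive c ≤ n says that c has a zero entry, hence ends in 0. So every entry ≥ 2 is followed by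
-- a positive one, which matches the entries ≥ 2 of c injectively with the positive entries of tail c.
#positive-∸1≤tail : ∀ {n} {c : Fin (suc n) → ℕ} → Smooth c → #positive c ≤ n →
                    #positive ((_∸ 1) ∘ c) ≤ #positive (tail c)
#positive-∸1≤tail {zero} {c} s #c≤0 with c zero
#positive-∸1≤tail {zero} s _  | zero  = z≤n
#positive-∸1≤tail {zero} s () | suc _
#positive-∸1≤tail {suc n} {c} s #c≤n with c zero | proj₂ (smooth-head s)
... | zero  | _    = #positive-∸1≤ (tail c)
... | suc _ | x≤c₁ = +-mono-≤ (sgn-mono-≤ x≤c₁) (#positive-∸1≤tail (smooth-tail s) (s≤s⁻¹ #c≤n))

#positive-∸1 : ∀ {n} {c : Fin (suc n) → ℕ} → Smooth c → #positive c ≤ n →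
               #positive ((_∸ 1) ∘ c) ≤ #positive c ∸ 1
#positive-∸1 s #c≤n = ≤-trans (#positive-∸1≤tail s #c≤n) (#positive-tail s)

∑-≤-staircase : ∀ {n} p {c : Fin (suc n) → ℕ} {r : Fin p → ℕ} → Smooth c → #positive c ≤ n →
                (∀ j → c j ≤ p) → (∀ i → #positive c ∸ toℕ i ≤ r i) → ∑ c ≤ ∑ r
∑-≤-staircase zero    s _ c≤0 _ = ∑-≤-0 c≤0
∑-≤-staircase {n} (suc p) {c} {r} s #c≤n c≤p staircase≤r = begin
  ∑ c                            ≡⟨ ∑≡#positive+∑∸1 c ⟩
  #positive c + ∑ ((_∸ 1) ∘ c)   ≤⟨ +-mono-≤ (staircase≤r zero)
                                      (∑-≤-staircase p (smooth-∸1 s) #c′≤n c′≤p staircase′≤tail-r) ⟩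
  r zero + ∑ (tail r)            ∎
  where
  open ≤-Reasoning
  #c′≤n : #positive ((_∸ 1) ∘ c) ≤ n
  #c′≤n = ≤-trans (#positive-∸1≤ c) #c≤n
  c′≤p : ∀ j → c j ∸ 1 ≤ p
  c′≤p j = ∸-monoˡ-≤ 1 (c≤p j)
  staircase′≤tail-r : ∀ i → #positive ((_∸ 1) ∘ c) ∸ toℕ i ≤ r (suc i)
  staircase′≤tail-r i = begin
    #positive ((_∸ 1) ∘ c) ∸ toℕ i   ≤⟨ ∸-monoˡ-≤ (toℕ i) (#positive-∸1 s #c≤n) ⟩
    #positive c ∸ 1 ∸ toℕ i          ≡⟨ ∸-+-assoc (#positive c) 1 (toℕ i) ⟩
    #positive c ∸ suc (toℕ i)        ≤⟨ staircase≤r (suc i) ⟩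
    r (suc i)                        ∎

head≤#positive : ∀ {p n} {r : Fin (suc p) → ℕ} {c : Fin (suc n) → ℕ} → Smooth r → Smooth c →
                 r zero ≤ suc n → (∀ j → c j ≤ suc p) → ∑ r ≡ ∑ c → r zero ≤ #positive c
head≤#positive {p} {n} {r} {c} sr sc r₀≤1+n c≤1+p ∑r≡∑c with r zero ≤? #positive c
... | yes r₀≤#c = r₀≤#c
... | no  r₀≰#c = contradiction (sym ∑r≡∑c) (<⇒≢ ∑c<∑r)
  where
  open ≤-Reasoning
  #c<r₀ : #positive c < r zero
  #c<r₀ = ≰⇒> r₀≰#c
  #c≤n : #positive c ≤ n
  #c≤n = s≤s⁻¹ (≤-trans #c<r₀ r₀≤1+n)
  staircase≤r : ∀ i → #positive c ∸ toℕ i ≤ (#positive c ∷ tail r) i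
  staircase≤r zero    = ≤-refl
  staircase≤r (suc i) = ≤-trans (∸-monoˡ-≤ (suc (toℕ i)) (<⇒≤ #c<r₀)) (smooth-head-∸-≤ sr (suc i))
  ∑c<∑r : ∑ c < ∑ r
  ∑c<∑r = begin-strict
    ∑ c                        ≤⟨ ∑-≤-staircase (suc p) sc #c≤n c≤1+p staircase≤r ⟩
    #positive c + ∑ (tail r)   <⟨ +-monoˡ-< (∑ (tail r)) #c<r₀ ⟩
    ∑ r                        ∎

leadingRun : ∀ {n} → (Fin (suc n) → ℕ) → ℕ
leadingRun {zero}  c = 1
leadingRun {suc n} c with c (suc zero) ≟ c zero
... | yes _ = suc (leadingRun (tail c))
... | no  _ = 1

leadingRun≥1 : ∀ {n} (c : Fin (suc n) → ℕ) → 1 ≤ leadingRun c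
leadingRun≥1 {zero}  c = ≤-refl
leadingRun≥1 {suc n} c with c (suc zero) ≟ c zero
... | yes _ = s≤s z≤n
... | no  _ = ≤-refl

leadingRun-*-≤-∑ : ∀ {n} (g : ℕ → ℕ) (c : Fin (suc n) → ℕ) → leadingRun c * g (c zero) ≤ ∑ (g ∘ c)
leadingRun-*-≤-∑ {zero}  g c = ≤-refl
leadingRun-*-≤-∑ {suc n} g c with c (suc zero) ≟ c zero
... | yes c₁≡c₀ = +-monoʳ-≤ (g (c zero)) (subst (λ v → leadingRun (tail c) * g v ≤ ∑ (g ∘ tail c))
                                                c₁≡c₀ (leadingRun-*-≤-∑ g (tail c)))
... | no  _     = +-monoʳ-≤ (g (c zero)) z≤n

leadingRun≤head : ∀ {p n} {r : Fin (suc p) → ℕ} {c : Fin (suc n) → ℕ} → Smooth r →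
                  ∑ r ≡ ∑ c → c zero ≡ suc p → leadingRun c ≤ r zero
leadingRun≤head {p} {r = r} {c} sr ∑r≡∑c c₀≡1+p = *-cancelʳ-≤ (leadingRun c) (r zero) (suc p) (begin
  leadingRun c * suc p     ≡⟨ cong (leadingRun c *_) c₀≡1+p ⟨
  leadingRun c * c zero    ≤⟨ leadingRun-*-≤-∑ id c ⟩
  ∑ c                      ≡⟨ ∑r≡∑c ⟨
  ∑ r                      ≤⟨ ∑-≤-* (smooth-head-max sr) ⟩
  suc p * r zero           ≡⟨ *-comm (suc p) (r zero) ⟩
  r zero * suc p           ∎)
  where open ≤-Reasoning

-- The k largest entries of a nonincreasing c, the rightmost ones among equal entries: a run of equal
-- entries is skipped from its left end as long as it is longer than the number k of entries still to take.
select : ∀ {n} → (Fin n → ℕ) → ℕ → Fin n → Bool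
select {zero}  c k ()
select {suc n} c k with leadingRun c ≤? k
... | yes _ = true  ∷ select (tail c) (k ∸ 1)
... | no  _ = false ∷ select (tail c) k

select-head-true : ∀ {n} {c : Fin (suc n) → ℕ} {k} → leadingRun c ≤ k → select c k zero ≡ true
select-head-true {c = c} {k} run≤k with leadingRun c ≤? k
... | yes _     = refl
... | no  run≰k = contradiction run≤k run≰k

select-head-false : ∀ {n} {c : Fin (suc n) → ℕ} {k} → ¬ leadingRun c ≤ k → select c k zero ≡ false
select-head-false {c = c} {k} run≰k with leadingRun c ≤? k
... | yes run≤k = contradiction run≤k run≰k
... | no  _     = refl

∸1≤#positive-tail : ∀ {n k} (c : Fin (suc n) → ℕ) → k ≤ #positive c → k ∸ 1 ≤ #positive (tail c)
∸1≤#positive-tail {k = k} c k≤#c with c zero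
... | zero  = ≤-trans (m∸n≤m k 1) k≤#c
... | suc _ = ∸-monoˡ-≤ 1 k≤#c

<leadingRun⇒≤#positive-tail : ∀ {n k} (c : Fin (suc n) → ℕ) → k ≤ #positive c → k < leadingRun c →
                              k ≤ #positive (tail c)
<leadingRun⇒≤#positive-tail {k = k} c k≤#c k<run with c zero | leadingRun-*-≤-∑ sgn c
... | zero  | _         = k≤#c
... | suc _ | run*1≤#c = s≤s⁻¹ (≤-trans k<run (≤-trans (≤-reflexive (sym (*-identityʳ _))) run*1≤#c))

select-count : ∀ {n} (c : Fin n → ℕ) k → k ≤ #positive c → ∑ (bit ∘ select c k) ≡ k
select-count {zero}  c k k≤0 = sym (n≤0⇒n≡0 k≤0)
select-count {suc n} c k k≤#c with leadingRun c ≤? k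
... | yes run≤k = trans (cong suc (select-count (tail c) (k ∸ 1) (∸1≤#positive-tail c k≤#c)))
                        (m+[n∸m]≡n (≤-trans (leadingRun≥1 c) run≤k))
... | no  run≰k = select-count (tail c) k (<leadingRun⇒≤#positive-tail c k≤#c (≰⇒> run≰k))

select-≤ : ∀ {n} {c : Fin n → ℕ} {k} → Smooth c → k ≤ #positive c → ∀ j → bit (select c k j) ≤ c j
select-≤ {suc n} {c} {k} s k≤#c j with leadingRun c ≤? k | j
... | yes run≤k | zero   = head-positive s (≤-trans (≤-trans (leadingRun≥1 c) run≤k) k≤#c)
... | yes _     | suc j′ = select-≤ (smooth-tail s) (∸1≤#positive-tail c k≤#c) j′
... | no  _     | zero   = z≤n
... | no  run≰k | suc j′ = select-≤ (smooth-tail s) (<leadingRun⇒≤#positive-tail c k≤#c (≰⇒> run≰k)) j′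

select-step-taken : ∀ {n} {c : Fin (suc (suc n)) → ℕ} {k} → Smooth c → leadingRun c ≤ k →
                    SmoothStep (c zero ∸ 1) (c (suc zero) ∸ bit (select (tail c) (k ∸ 1) zero))
select-step-taken {c = c} {k} s run≤k with c (suc zero) ≟ c zero
... | yes c₁≡c₀ = subst₂ (λ v b → SmoothStep (c zero ∸ 1) (v ∸ bit b)) (sym c₁≡c₀) (sym b≡true)
                    (smoothStep-∸-bit (c zero ∸ 1) false)
  where
  b≡true : select (tail c) (k ∸ 1) zero ≡ true
  b≡true = select-head-true {c = tail c} (∸-monoˡ-≤ 1 run≤k)
... | no  c₁≢c₀ = subst (λ v → SmoothStep (c zero ∸ 1) (v ∸ bit b)) (sym (smoothStep-≢ (smooth-head s) c₁≢c₀))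
                    (smoothStep-∸-bit (c zero ∸ 1) b)
  where b = select (tail c) (k ∸ 1) zero

select-step-skipped : ∀ {n} {c : Fin (suc (suc n)) → ℕ} {k} → Smooth c → ¬ leadingRun c ≤ k →
                      SmoothStep (c zero) (c (suc zero) ∸ bit (select (tail c) k zero))
select-step-skipped {c = c} {k} s run≰k with c (suc zero) ≟ c zero
... | yes c₁≡c₀ = subst (λ v → SmoothStep (c zero) (v ∸ bit b)) (sym c₁≡c₀) (smoothStep-∸-bit (c zero) b)
  where b = select (tail c) k zero
... | no  _     = subst (λ b → SmoothStep (c zero) (c (suc zero) ∸ bit b)) (sym b≡false) (smooth-head s)
  where
  k≡0 : k ≡ 0
  k≡0 = n≤0⇒n≡0 (s≤s⁻¹ (≰⇒> run≰k))
  b≡false : select (tail c) k zero ≡ false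
  b≡false = select-head-false {c = tail c}
              (λ run≤k → ≤⇒≯ (subst (leadingRun (tail c) ≤_) k≡0 run≤k) (leadingRun≥1 (tail c)))

select-smooth : ∀ {n} {c : Fin n → ℕ} {k} → Smooth c → Smooth (c ∸ᵇ select c k)
select-smooth {zero}        s ()
select-smooth {suc zero}    s = smooth-singleton _
select-smooth {suc (suc n)} {c} {k} s
  with leadingRun c ≤? k | select-smooth {k = k ∸ 1} (smooth-tail s) | select-smooth {k = k} (smooth-tail s)
... | yes run≤k | taken-smooth | _              = smooth-∷ (select-step-taken s run≤k) taken-smooth
... | no  run≰k | _            | skipped-smooth = smooth-∷ (select-step-skipped s run≰k) skipped-smooth

select-lowers-max : ∀ {n} {c : Fin (suc n) → ℕ} {k} → Smooth c → leadingRun c ≤ k →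
                    ∀ j → (c ∸ᵇ select c k) j ≤ c zero ∸ 1
select-lowers-max {c = c} {k} s run≤k j with leadingRun c ≤? k | j
... | no  run≰k | _    = contradiction run≤k run≰k
... | yes _     | zero = ≤-refl
select-lowers-max {suc n} {c} {k} s run≤k j | yes _ | suc j′ with c (suc zero) ≟ c zero
... | yes c₁≡c₀ = subst (λ v → (tail c ∸ᵇ select (tail c) (k ∸ 1)) j′ ≤ v ∸ 1) c₁≡c₀
                    (select-lowers-max (smooth-tail s) (∸-monoˡ-≤ 1 run≤k) j′)
... | no  c₁≢c₀ = begin
  (tail c ∸ᵇ select (tail c) (k ∸ 1)) j′   ≤⟨ m∸n≤m (c (suc j′)) (bit (select (tail c) (k ∸ 1) j′)) ⟩
  c (suc j′)                               ≤⟨ smooth-head-max (smooth-tail s) j′ ⟩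
  c (suc zero)                             ≡⟨ smoothStep-≢ (smooth-head s) c₁≢c₀ ⟩
  c zero ∸ 1                               ∎
  where open ≤-Reasoning

select-∸ᵇ-≤ : ∀ {p n k} {c : Fin (suc n) → ℕ} → Smooth c → c zero ≤ suc p →
              (c zero ≡ suc p → leadingRun c ≤ k) → ∀ j → (c ∸ᵇ select c k) j ≤ p
select-∸ᵇ-≤ {k = k} {c} s c₀≤1+p run≤k j with m≤n⇒m<n∨m≡n c₀≤1+p
... | inj₁ c₀≤p   =
  ≤-trans (m∸n≤m (c j) (bit (select c k j))) (≤-trans (smooth-head-max s j) (s≤s⁻¹ c₀≤p))
... | inj₂ c₀≡1+p =
  ≤-trans (select-lowers-max s (run≤k c₀≡1+p) j) (≤-reflexive (cong (_∸ 1) c₀≡1+p))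

Realizes : ∀ {m n} → BinMatrix m n → (Fin m → ℕ) → (Fin n → ℕ) → Set
Realizes A r c = (∀ i → rowSum A i ≡ r i) × (∀ j → colSum A j ≡ c j)

realizes-∷ : ∀ {m n} {d : Fin n → Bool} {A : BinMatrix m n} {r : Fin (suc m) → ℕ} {c : Fin n → ℕ} →
             ∑ (bit ∘ d) ≡ r zero → (∀ j → bit (d j) ≤ c j) → Realizes A (tail r) (c ∸ᵇ d) →
             Realizes (d ∷ A) r c
realizes-∷ {d = d} {A} {r} {c} row₀ d≤c (rows , cols) = rows′ , cols′
  where
  rows′ : ∀ i → rowSum (d ∷ A) i ≡ r i
  rows′ zero    = row₀
  rows′ (suc i) = rows i
  cols′ : ∀ j → colSum (d ∷ A) j ≡ c j
  cols′ j = trans (cong (bit (d j) +_) (cols j)) (m+[n∸m]≡n (d≤c j))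

realization : ∀ p {n} (r : Fin p → ℕ) (c : Fin (suc n) → ℕ) → ∑ r ≡ ∑ c →
              (∀ i → r i ≤ suc n) → (∀ j → c j ≤ p) → Smooth r → Smooth c →
              Σ (BinMatrix p (suc n)) (λ A → Realizes A r c)
realization zero    r c _ _ c≤0 _ _ = (λ ()) , (λ ()) , λ j → sym (n≤0⇒n≡0 (c≤0 j))
realization (suc p) {n} r c ∑r≡∑c r≤1+n c≤1+p sr sc =
  let A , realizesA = realization p (tail r) (c ∸ᵇ d) ∑tail-r≡∑c′ (r≤1+n ∘ suc) c′≤p
                                  (smooth-tail sr) (select-smooth sc)
  in  d ∷ A , realizes-∷ (select-count c (r zero) fits) d≤c realizesA
  where
  fits : r zero ≤ #positive c
  fits = head≤#positive sr sc (r≤1+n zero) c≤1+p ∑r≡∑c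
  d : Fin (suc n) → Bool
  d = select c (r zero)
  d≤c : ∀ j → bit (d j) ≤ c j
  d≤c = select-≤ sc fits
  c′≤p : ∀ j → (c ∸ᵇ d) j ≤ p
  c′≤p = select-∸ᵇ-≤ sc (c≤1+p zero) (leadingRun≤head {r = r} {c} sr ∑r≡∑c)
  ∑tail-r≡∑c′ : ∑ (tail r) ≡ ∑ (c ∸ᵇ d)
  ∑tail-r≡∑c′ = +-cancelˡ-≡ (r zero) _ _ (begin
    r zero + ∑ (tail r)        ≡⟨ ∑r≡∑c ⟩
    ∑ c                        ≡⟨ ∑-∸ᵇ d≤c ⟩
    ∑ (bit ∘ d) + ∑ (c ∸ᵇ d)   ≡⟨ cong (_+ ∑ (c ∸ᵇ d)) (select-count c (r zero) fits) ⟩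
    r zero + ∑ (c ∸ᵇ d)        ∎)
    where open ≡-Reasoning

lemma2 : (m : ℕ) → 1 ≤ m → (r c : Fin m → ℕ) →
         ∑ r ≡ ∑ c →
         (∀ i → r i ≤ m) → (∀ i → c i ≤ m) →
         (∀ i j → toℕ i + 1 ≡ toℕ j → r j ≤ r i × r i ∸ 1 ≤ r j) →
         (∀ i j → toℕ i + 1 ≡ toℕ j → c j ≤ c i × c i ∸ 1 ≤ c j) →
         Σ (BinMatrix m m) (λ A → (∀ i → rowSum A i ≡ r i) × (∀ j → colSum A j ≡ c j))
lemma2 (suc m) _ r c ∑r≡∑c r≤m c≤m smooth-r smooth-c =
  realization (suc m) r c ∑r≡∑c r≤m c≤m smooth-r smooth-c
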